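{- Let $$P_1(y)=1+177710598\,y^3+17738799316992\,y^6+7466750649114265387008\,y^9+123267709616967231382892912798859264\,y^{15}+945048866667847329755658073857921409357870792704\,y^{21}+2867531822071470533473102364531302968788957393604240929193984\,y^{27},$$ $$P_2(y)=-1+177710598\,y^3-17738799316992\,y^6+7466750649114265387008\,y^9+123267709616967231382892912798859264\,y^{15}+945048866667847329755658073857921409357870792704\,y^{21}+2867531822071470533473102364531302968788957393604240929193984\,y^{27},$$ $$P_3(y)=234\,y^2\bigl(2455+83248185194643456\,y^6+974937062077718261926943784960\,y^{12}+4087723046938680100330712454833737367027712\,y^{18}\bigr).$$ Then the identity $P_1(y)^3-P_2(y)^3-P_3(y)^3=2+8606991384576\,y^6$ holds in $\mathbb{Z}[y]$.
   Context: Here $y$ is an indeterminate. -}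

module Defs where

open import Data.Nat using (ℕ; zero; suc)
open import Data.Integer using (ℤ; +_; -[1+_]; _+_; _*_; -_)
open import Data.List using (List; []; _∷_; map; replicate; _++_; [_])
open import Relation.Binary.PropositionalEquality using (_≡_)

-- Univariate polynomials over ℤ in the indeterminate y, represented by
-- coefficient lists (constant term first). Lists differing only by
-- trailing zeros represent the same polynomial.
Poly : Set
Poly = List ℤ

infixl 6 _⊕_ _⊖_
infixl 7 _⊗_

_⊕_ : Poly → Poly → Poly
[] ⊕ q = q
(a ∷ p) ⊕ [] = a ∷ p
(a ∷ p) ⊕ (b ∷ q) = (a + b) ∷ (p ⊕ q)

scale : ℤ → Poly → Poly
scale c = map (c *_)

_⊗_ : Poly → Poly → Poly
[] ⊗ q = []
(a ∷ p) ⊗ q = scale a q ⊕ (+ 0 ∷ (p ⊗ q))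

negP : Poly → Poly
negP = map -_

_⊖_ : Poly → Poly → Poly
p ⊖ q = p ⊕ negP q

cube : Poly → Poly
cube p = p ⊗ p ⊗ p

mon : ℤ → ℕ → Poly
mon c n = replicate n (+ 0) ++ [ c ]

private
  cons : ℤ → Poly → Poly
  cons (+ zero) [] = []
  cons a [] = [ a ]
  cons a (b ∷ p) = a ∷ b ∷ p

norm : Poly → Poly
norm [] = []
norm (a ∷ p) = cons a (norm p)

infix 4 _≈ₚ_
_≈ₚ_ : Poly → Poly → Set
p ≈ₚ q = norm p ≡ norm q

P₁ : Poly
P₁ = mon (+ 1) 0 ⊕ mon (+ 177710598) 3 ⊕ mon (+ 17738799316992) 6
   ⊕ mon (+ 7466750649114265387008) 9
   ⊕ mon (+ 123267709616967231382892912798859264) 15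
   ⊕ mon (+ 945048866667847329755658073857921409357870792704) 21
   ⊕ mon (+ 2867531822071470533473102364531302968788957393604240929193984) 27

P₂ : Poly
P₂ = mon (- (+ 1)) 0 ⊕ mon (+ 177710598) 3 ⊕ mon (- (+ 17738799316992)) 6
   ⊕ mon (+ 7466750649114265387008) 9
   ⊕ mon (+ 123267709616967231382892912798859264) 15
   ⊕ mon (+ 945048866667847329755658073857921409357870792704) 21
   ⊕ mon (+ 2867531822071470533473102364531302968788957393604240929193984) 27

P₃ : Poly
P₃ = mon (+ 234) 2 ⊗
     ( mon (+ 2455) 0 ⊕ mon (+ 83248185194643456) 6
     ⊕ mon (+ 974937062077718261926943784960) 12
     ⊕ mon (+ 4087723046938680100330712454833737367027712) 18 )

RHS : Poly
RHS = mon (+ 2) 0 ⊕ mon (+ 8606991384576) 6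

module Submission where

open import Data.Integer using (ℤ; +_)
open import Data.List using (List; []; _∷_)
open import Relation.Binary.PropositionalEquality using (_≡_; refl; trans; sym)

open import Defs

target : List ℤ
target = + 2 ∷ + 0 ∷ + 0 ∷ + 0 ∷ + 0 ∷ + 0 ∷ + 8606991384576 ∷ []

lhs-normal-form : norm (cube P₁ ⊖ cube P₂ ⊖ cube P₃) ≡ target
lhs-normal-form = refl

rhs-normal-form : norm RHS ≡ target
rhs-normal-form = refl

mainTheorem4 : cube P₁ ⊖ cube P₂ ⊖ cube P₃ ≈ₚ RHS
mainTheorem4 = trans lhs-normal-form (sym rhs-normal-form)
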